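{- Let $n\ge1$ be an integer, $\mathbb{F}$ a finite field, and $f\colon\mathbb{F}\to\mathbb{F}$ a non-linear function. For $t\in\mathbb{F}$ let $I_f(t):=\{f(x)+tx:x\in\mathbb{F}\}$. Then there exists a rank-$1$ Kakeya set $K\subseteq\mathbb{F}^n$ with $$|K|=\sum_{t\in\mathbb{F}}\frac{|I_f(t)|^n-1}{|I_f(t)|-1}.$$
   Context: A function $f\colon\mathbb{F}\to\mathbb{F}$ is non-linear if it is not of the form $x\mapsto ax+b$ with $a,b\in\mathbb{F}$ (so that $|I_f(t)|>1$ for all $t$). A subset $K\subseteq\mathbb{F}^n$ is a rank-$1$ Kakeya set if for every one-dimensional subspace $L\le\mathbb{F}^n$ there exists $v\in\mathbb{F}^n$ with $v+L\subseteq K$. -}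

module Defs where

open import Level using (0ℓ)
open import Data.Nat as ℕ using (ℕ; zero; suc; _∸_; _^_)
open import Data.Nat.DivMod using (_/_)
open import Data.Fin using (Fin)
open import Data.List using (List; length; map; deduplicate)
open import Data.List.Membership.Propositional using (_∈_)
open import Data.List.Relation.Unary.Unique.Propositional using (Unique)
open import Data.Vec using (Vec; zipWith; replicate) renaming (map to vmap)
open import Data.Product using (∃; ∃-syntax; _×_)
open import Relation.Nullary using (¬_)
open import Relation.Binary.PropositionalEquality using (_≡_)
open import Relation.Binary.Definitions using (DecidableEquality)

import Algebra.Structures as AS

record FiniteField : Set₁ where
  infixl 6 _+_
  infixl 7 _*_
  field
    Carrier   : Set
    _≟_       : DecidableEquality Carrier
    _+_ _*_   : Carrier → Carrier → Carrier
    -_        : Carrier → Carrier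
    0# 1#     : Carrier
    isCommutativeRing : AS.IsCommutativeRing _≡_ _+_ _*_ -_ 0# 1#
    0≢1       : ¬ (0# ≡ 1#)
    inverse   : ∀ x → ¬ (x ≡ 0#) → ∃[ y ] (x * y ≡ 1#)
    elements  : List Carrier
    complete  : ∀ x → x ∈ elements
    unique    : Unique elements

module _ (𝔽 : FiniteField) where
  open FiniteField 𝔽

  IsLinear : (Carrier → Carrier) → Set
  IsLinear f = ∃[ a ] ∃[ b ] (∀ x → f x ≡ a * x + b)

  NonLinear : (Carrier → Carrier) → Set
  NonLinear f = ¬ IsLinear f

  cardI : (Carrier → Carrier) → Carrier → ℕ
  cardI f t = length (deduplicate _≟_ (map (λ x → f x + t * x) elements))

  _+ᵛ_ : ∀ {n} → Vec Carrier n → Vec Carrier n → Vec Carrier n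
  _+ᵛ_ = zipWith _+_

  _·ᵛ_ : ∀ {n} → Carrier → Vec Carrier n → Vec Carrier n
  s ·ᵛ v = vmap (s *_) v

  zeroᵛ : ∀ {n} → Vec Carrier n
  zeroᵛ = replicate _ 0#

  IsRank1Kakeya : ∀ n → (Vec Carrier n → Set) → Set
  IsRank1Kakeya n K =
    ∀ (d : Vec Carrier n) → ¬ (d ≡ zeroᵛ) →
      ∃[ v ] (∀ s → K (v +ᵛ (s ·ᵛ d)))

quot : ℕ → ℕ → ℕ
quot a zero    = 0
quot a (suc k) = a / suc k

{-# OPTIONS --safe #-}
module Submission where

-- Write φ t x = f x + t x and I(t) = φ t (𝔽).  The list
--   P(0) = ∅,   P(n+1) = {0} × P(n)  ∪  ⋃ₜ {t} × I(t)ⁿ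
-- is a rank-1 Kakeya set: a direction (0, d) is handled inside {0} × P(n), and a direction
-- (d₀, d) with d₀ ≠ 0 by the line through (0, f(d/d₀)), whose point with first coordinate t
-- is (t, f(d/d₀) + t d/d₀) ∈ {t} × I(t)ⁿ.  Counted with multiplicity, P(n) has
-- N = ∑ₜ (|I(t)|ⁿ − 1)/(|I(t)| − 1) elements, so it suffices to pad it with further vectors up
-- to exactly N distinct ones, which is possible as soon as N ≤ qⁿ.  By induction on n this
-- reduces to ∑ₜ |I(t)| ≤ q² − q.  Every x ≠ 0 collides with 0 under φ t for exactly one t, which
-- loses q − 1 values in total; since f is not affine, some φ t has a further collision away from
-- the class of 0, which loses one more.

open import Defs
open import Level using (0ℓ)
open import Algebra.Bundles using (CommutativeRing)
open import Data.Bool.Base using (if_then_else_)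
open import Data.Empty using (⊥-elim)
open import Data.List.Base
  using (List; []; _∷_; [_]; length; map; _++_; filter; concatMap; deduplicate; cartesianProductWith; take)
open import Data.List.Properties
  using (length-++; length-map; length-take; length-removeAt′; length-deduplicate; take++drop≡id)
open import Data.List.Membership.Propositional using (_∈_)
open import Data.List.Membership.Propositional.Properties
  using (∈-map⁺; ∈-map⁻; ∈-++⁺ˡ; ∈-++⁺ʳ; ∈-filter⁺; ∈-filter⁻; ∈-deduplicate⁺; ∈-deduplicate⁻;
         ∈-concatMap⁺; ∈-cartesianProductWith⁺)
import Data.List.Membership.DecPropositional as DecMembership
open import Data.List.Relation.Binary.Subset.Propositional using (_⊆_)
import Data.List.Relation.Unary.All as All
open import Data.List.Relation.Unary.Any as Any using (here; there; _─_; any?)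
open import Data.List.Relation.Unary.AllPairs using ([]; _∷_)
open import Data.List.Relation.Unary.Unique.Propositional using (Unique)
import Data.List.Relation.Unary.Unique.Propositional.Properties as Unique
open import Data.List.Relation.Unary.Unique.DecPropositional.Properties using (deduplicate-!)
open import Data.Nat.Base using (ℕ; zero; suc; _^_; _∸_; _≤_; _≥_; z≤n; s≤s)
import Data.Nat.Base as ℕ
open import Data.Nat.Properties using (≤-reflexive)
open import Data.Nat.DivMod using (_/_; m*n/n≡m)
open import Data.Nat.ListAction using (sum)
open import Data.Product using (∃-syntax; _×_; _,_; proj₂)
open import Data.Sum using (_⊎_; inj₁; inj₂)
open import Data.Vec.Base using (Vec; []; _∷_; zipWith) renaming (map to vmap)
open import Data.Vec.Properties using (∷-injective; ≡-dec)
import Data.Vec.Relation.Unary.All as VecAll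
import Data.Vec.Relation.Unary.All.Properties as VecAll
open import Function.Base using (_∘_)
open import Function.Bundles using (_⇔_; mk⇔; Equivalence)
open import Relation.Nullary using (¬_; Dec; does; ¬?)
open import Relation.Nullary.Decidable using (yes; no; _×-dec_; _⊎-dec_; decidable-stable)
open import Relation.Binary.Definitions using (DecidableEquality)
open import Relation.Binary.PropositionalEquality
  using (_≡_; refl; sym; trans; cong; cong₂; subst; subst₂; module ≡-Reasoning)

module FiniteSums where
  open import Data.Nat.Base using (_+_; _*_)
  open import Data.Nat.Properties
  open import Algebra.Properties.CommutativeSemigroup +-commutativeSemigroup
    using () renaming (interchange to +-interchange)

  module _ {A : Set} where

    ∑ : List A → (A → ℕ) → ℕ
    ∑ xs h = sum (map h xs)

    ∑-cong : ∀ xs {g h : A → ℕ} → (∀ x → g x ≡ h x) → ∑ xs g ≡ ∑ xs h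
    ∑-cong []       g≡h = refl
    ∑-cong (x ∷ xs) g≡h = cong₂ _+_ (g≡h x) (∑-cong xs g≡h)

    ∑-mono-≤ : ∀ xs {g h : A → ℕ} → (∀ x → g x ≤ h x) → ∑ xs g ≤ ∑ xs h
    ∑-mono-≤ []       g≤h = z≤n
    ∑-mono-≤ (x ∷ xs) g≤h = +-mono-≤ (g≤h x) (∑-mono-≤ xs g≤h)

    ∑-zero : ∀ xs → ∑ xs (λ _ → 0) ≡ 0
    ∑-zero []       = refl
    ∑-zero (_ ∷ xs) = ∑-zero xs

    ∑-const : ∀ xs c → ∑ xs (λ _ → c) ≡ length xs * c
    ∑-const []       c = refl
    ∑-const (_ ∷ xs) c = cong (c +_) (∑-const xs c)

    ∑-+ : ∀ xs (g h : A → ℕ) → ∑ xs (λ x → g x + h x) ≡ ∑ xs g + ∑ xs h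
    ∑-+ []       g h = refl
    ∑-+ (x ∷ xs) g h =
      trans (cong (g x + h x +_) (∑-+ xs g h)) (+-interchange (g x) (h x) (∑ xs g) (∑ xs h))

    ∑-*ˡ : ∀ xs c (h : A → ℕ) → ∑ xs (λ x → c * h x) ≡ c * ∑ xs h
    ∑-*ˡ []       c h = sym (*-zeroʳ c)
    ∑-*ˡ (x ∷ xs) c h = trans (cong (c * h x +_) (∑-*ˡ xs c h)) (sym (*-distribˡ-+ c (h x) (∑ xs h)))

  ∑-comm : ∀ {A B : Set} xs (ys : List B) (h : A → B → ℕ) →
           ∑ xs (λ x → ∑ ys (h x)) ≡ ∑ ys (λ y → ∑ xs (λ x → h x y))
  ∑-comm []       ys h = sym (∑-zero ys)
  ∑-comm (x ∷ xs) ys h = trans (cong (∑ ys (h x) +_) (∑-comm xs ys h)) (sym (∑-+ ys (h x) _))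

  length-concatMap : ∀ {A B : Set} (h : A → List B) xs → length (concatMap h xs) ≡ ∑ xs (λ x → length (h x))
  length-concatMap h []       = refl
  length-concatMap h (x ∷ xs) = trans (length-++ (h x)) (cong (length (h x) +_) (length-concatMap h xs))

  𝟙 : ∀ {P : Set} → Dec P → ℕ
  𝟙 p = if does p then 1 else 0

  module _ {P Q : Set} where

    𝟙-⇔ : P ⇔ Q → (p : Dec P) (q : Dec Q) → 𝟙 p ≡ 𝟙 q
    𝟙-⇔ P⇔Q (yes _) (yes _)  = refl
    𝟙-⇔ P⇔Q (yes p) (no ¬q)  = ⊥-elim (¬q (Equivalence.to P⇔Q p))
    𝟙-⇔ P⇔Q (no ¬p) (yes q)  = ⊥-elim (¬p (Equivalence.from P⇔Q q))
    𝟙-⇔ P⇔Q (no _)  (no _)   = refl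

    𝟙-× : (p : Dec P) (q : Dec Q) → 𝟙 (p ×-dec q) ≡ 𝟙 p * 𝟙 q
    𝟙-× (yes _) q = sym (+-identityʳ (𝟙 q))
    𝟙-× (no _)  q = refl

    𝟙-⊎ : ¬ (P × Q) → (p : Dec P) (q : Dec Q) → 𝟙 (p ⊎-dec q) ≡ 𝟙 p + 𝟙 q
    𝟙-⊎ disjoint (yes p) (yes q) = ⊥-elim (disjoint (p , q))
    𝟙-⊎ disjoint (yes _) (no _)  = refl
    𝟙-⊎ disjoint (no _)  q       = refl

  𝟙-¬ : ∀ {P : Set} (p : Dec P) → 𝟙 (¬? p) + 𝟙 p ≡ 1
  𝟙-¬ (yes _) = refl
  𝟙-¬ (no _)  = refl

  module _ {A : Set} {P : A → Set} (P? : ∀ x → Dec (P x)) where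

    ∑-𝟙-complement : ∀ xs → ∑ xs (λ x → 𝟙 (¬? (P? x))) + ∑ xs (λ x → 𝟙 (P? x)) ≡ length xs
    ∑-𝟙-complement xs = begin
      ∑ xs (λ x → 𝟙 (¬? (P? x))) + ∑ xs (λ x → 𝟙 (P? x)) ≡⟨ ∑-+ xs _ _ ⟨
      ∑ xs (λ x → 𝟙 (¬? (P? x)) + 𝟙 (P? x))              ≡⟨ ∑-cong xs (λ x → 𝟙-¬ (P? x)) ⟩
      ∑ xs (λ _ → 1)                                     ≡⟨ ∑-const xs 1 ⟩
      length xs * 1                                      ≡⟨ *-identityʳ (length xs) ⟩
      length xs                                          ∎
      where open ≡-Reasoning

    length-filter≡∑𝟙 : ∀ xs → length (filter P? xs) ≡ ∑ xs (λ x → 𝟙 (P? x))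
    length-filter≡∑𝟙 []       = refl
    length-filter≡∑𝟙 (x ∷ xs) with P? x
    ... | yes _ = cong suc (length-filter≡∑𝟙 xs)
    ... | no _  = length-filter≡∑𝟙 xs

  module _ {A : Set} (_≟_ : DecidableEquality A) where

    ∑-𝟙-≢ : ∀ {xs a} → All.All (λ x → ¬ a ≡ x) xs → ∑ xs (λ x → 𝟙 (x ≟ a)) ≡ 0
    ∑-𝟙-≢ {[]}         All.[]            = refl
    ∑-𝟙-≢ {x ∷ xs} {a} (a≢x All.∷ a∉xs) with x ≟ a
    ... | yes refl = ⊥-elim (a≢x refl)
    ... | no _     = ∑-𝟙-≢ a∉xs

    ∑-𝟙-≡ : ∀ {xs a} → Unique xs → a ∈ xs → ∑ xs (λ x → 𝟙 (x ≟ a)) ≡ 1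
    ∑-𝟙-≡ {x ∷ xs} {a} (x∉xs ∷ xs!) a∈x∷xs with x ≟ a | a∈x∷xs
    ... | yes refl | _          = cong suc (∑-𝟙-≢ x∉xs)
    ... | no x≢a   | here refl  = ⊥-elim (x≢a refl)
    ... | no _     | there a∈xs = ∑-𝟙-≡ xs! a∈xs

  geometric : ℕ → ℕ → ℕ
  geometric zero    m = 0
  geometric (suc n) m = geometric n m + m ^ n

  geometric-closedForm : ∀ n j → geometric n (suc (suc j)) * suc j + 1 ≡ suc (suc j) ^ n
  geometric-closedForm zero    j = refl
  geometric-closedForm (suc n) j = begin
    (G + m ^ n) * suc j + 1         ≡⟨ cong (_+ 1) (*-distribʳ-+ (suc j) G (m ^ n)) ⟩
    G * suc j + m ^ n * suc j + 1   ≡⟨ +-assoc (G * suc j) (m ^ n * suc j) 1 ⟩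
    G * suc j + (m ^ n * suc j + 1) ≡⟨ cong (G * suc j +_) (+-comm (m ^ n * suc j) 1) ⟩
    G * suc j + (1 + m ^ n * suc j) ≡⟨ +-assoc (G * suc j) 1 (m ^ n * suc j) ⟨
    G * suc j + 1 + m ^ n * suc j   ≡⟨ cong (_+ m ^ n * suc j) (geometric-closedForm n j) ⟩
    m ^ n + m ^ n * suc j           ≡⟨ cong (m ^ n +_) (*-comm (m ^ n) (suc j)) ⟩
    m * m ^ n                       ∎
    where
    open ≡-Reasoning
    m = suc (suc j)
    G = geometric n m

  quot≡geometric : ∀ n {m} → 2 ≤ m → quot (m ^ n ∸ 1) (m ∸ 1) ≡ geometric n m
  quot≡geometric n {suc zero}    (s≤s ())
  quot≡geometric n {suc (suc j)} _ = begin
    (m ^ n ∸ 1) / suc j         ≡⟨ cong (λ k → (k ∸ 1) / suc j) (geometric-closedForm n j) ⟨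
    (G * suc j + 1 ∸ 1) / suc j ≡⟨ cong (_/ suc j) (m+n∸n≡m (G * suc j) 1) ⟩
    G * suc j / suc j           ≡⟨ m*n/n≡m G (suc j) ⟩
    G                           ∎
    where
    open ≡-Reasoning
    m = suc (suc j)
    G = geometric n m

  module _ {A : Set} (xs : List A) (m : A → ℕ) {q} (|xs|≡q : length xs ≡ q)
           (m≤q : ∀ x → m x ≤ q) (∑m+q≤q² : ∑ xs m + q ≤ q * q) where

    ∑-geometric-≤ : ∀ n → ∑ xs (λ x → geometric n (m x)) ≤ q ^ n
    ∑-geometric-≤ zero          = ≤-trans (≤-reflexive (∑-zero xs)) z≤n
    ∑-geometric-≤ (suc zero)    = ≤-reflexive (trans (∑-const xs 1) (cong (_* 1) |xs|≡q))
    ∑-geometric-≤ (suc (suc n)) = begin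
      ∑ xs (λ x → geometric (suc n) (m x) + m x ^ suc n)
        ≡⟨ ∑-+ xs _ _ ⟩
      ∑ xs (λ x → geometric (suc n) (m x)) + ∑ xs (λ x → m x ^ suc n)
        ≤⟨ +-mono-≤ (∑-geometric-≤ (suc n)) (∑-mono-≤ xs (λ x → *-monoʳ-≤ (m x) (^-monoˡ-≤ n (m≤q x)))) ⟩
      q ^ suc n + ∑ xs (λ x → m x * q ^ n)
        ≡⟨ cong (q ^ suc n +_) ∑m·qⁿ ⟩
      q * q ^ n + ∑ xs m * q ^ n
        ≡⟨ *-distribʳ-+ (q ^ n) q (∑ xs m) ⟨
      (q + ∑ xs m) * q ^ n
        ≤⟨ *-monoˡ-≤ (q ^ n) (≤-trans (≤-reflexive (+-comm q (∑ xs m))) ∑m+q≤q²) ⟩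
      q * q * q ^ n
        ≡⟨ *-assoc q q (q ^ n) ⟩
      q ^ suc (suc n) ∎
      where
      open ≤-Reasoning
      ∑m·qⁿ : ∑ xs (λ x → m x * q ^ n) ≡ ∑ xs m * q ^ n
      ∑m·qⁿ = trans (∑-cong xs (λ x → *-comm (m x) (q ^ n)))
                    (trans (∑-*ˡ xs (q ^ n) m) (*-comm (q ^ n) (∑ xs m)))

open FiniteSums

module DuplicateFreeLists where
  open import Data.Nat.Base using (_+_; _*_; _⊓_)
  open import Data.Nat.Properties

  module _ {A : Set} where

    ∈-─⁺ : ∀ {x y : A} {ys} (x∈ys : x ∈ ys) → y ∈ ys → ¬ y ≡ x → y ∈ (ys ─ x∈ys)
    ∈-─⁺ (here refl)  (here refl)  y≢x = ⊥-elim (y≢x refl)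
    ∈-─⁺ (here _)     (there y∈ys) _   = y∈ys
    ∈-─⁺ (there _)    (here refl)  _   = here refl
    ∈-─⁺ (there x∈ys) (there y∈ys) y≢x = there (∈-─⁺ x∈ys y∈ys y≢x)

    Unique-⊆⇒length-≤ : ∀ {xs ys : List A} → Unique xs → xs ⊆ ys → length xs ≤ length ys
    Unique-⊆⇒length-≤ {[]}          _            _     = z≤n
    Unique-⊆⇒length-≤ {x ∷ xs} {ys} (x∉xs ∷ xs!) xs⊆ys = begin
      suc (length xs)          ≤⟨ s≤s (Unique-⊆⇒length-≤ xs! xs⊆ys─x) ⟩
      suc (length (ys ─ x∈ys)) ≡⟨ length-removeAt′ ys _ ⟨
      length ys                ∎
      where
      open ≤-Reasoning
      x∈ys : x ∈ ys
      x∈ys = xs⊆ys (here refl)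
      xs⊆ys─x : xs ⊆ (ys ─ x∈ys)
      xs⊆ys─x y∈xs = ∈-─⁺ x∈ys (xs⊆ys (there y∈xs)) (λ y≡x → All.lookup x∉xs y∈xs (sym y≡x))

  module _ {A B : Set} (_≟_ : DecidableEquality B) (h : A → B) where

    length-deduplicate-map-≤ : ∀ {xs ys} → (∀ {x} → x ∈ xs → ∃[ y ] y ∈ ys × h y ≡ h x) →
                               length (deduplicate _≟_ (map h xs)) ≤ length ys
    length-deduplicate-map-≤ {xs} {ys} represented = begin
      length (deduplicate _≟_ (map h xs)) ≤⟨ Unique-⊆⇒length-≤ (deduplicate-! _≟_ _) image⊆ ⟩
      length (map h ys)                   ≡⟨ length-map h ys ⟩
      length ys                           ∎
      where
      open ≤-Reasoning
      image⊆ : deduplicate _≟_ (map h xs) ⊆ map h ys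
      image⊆ z∈ with ∈-map⁻ h (∈-deduplicate⁻ _≟_ (map h xs) z∈)
      ... | x , x∈xs , refl with represented x∈xs
      ... | y , y∈ys , hy≡hx = subst (_∈ map h ys) hy≡hx (∈-map⁺ h y∈ys)

  module _ {A : Set} (_≟_ : DecidableEquality A) where
    open DecMembership _≟_ using (_∈?_)

    Unique-⊇-ofLength : ∀ {U : List A} {N} → Unique U → N ≤ length U →
                        (xs : List A) → length xs ≤ N → ∃[ K ] Unique K × xs ⊆ K × length K ≡ N
    Unique-⊇-ofLength {U} {N} U! N≤|U| xs |xs|≤N = K , K! , xs⊆K , |K|≡N
      where
      core = deduplicate _≟_ xs
      new? = λ u → ¬? (u ∈? core)
      fresh = filter new? U
      K = core ++ take (N ∸ length core) fresh

      ∈-take : ∀ {u n} → u ∈ take n fresh → u ∈ fresh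
      ∈-take {u} {n} u∈ = subst (u ∈_) (take++drop≡id n fresh) (∈-++⁺ˡ u∈)

      K! : Unique K
      K! = Unique.++⁺ (deduplicate-! _≟_ xs) (Unique.take⁺ _ (Unique.filter⁺ new? U!))
             (λ (u∈core , u∈fresh) → proj₂ (∈-filter⁻ new? {xs = U} (∈-take u∈fresh)) u∈core)

      xs⊆K : xs ⊆ K
      xs⊆K x∈xs = ∈-++⁺ˡ (∈-deduplicate⁺ _≟_ x∈xs)

      U⊆core++fresh : U ⊆ core ++ fresh
      U⊆core++fresh {u} u∈U with u ∈? core
      ... | yes u∈core = ∈-++⁺ˡ u∈core
      ... | no u∉core  = ∈-++⁺ʳ core (∈-filter⁺ new? u∈U u∉core)

      |core|≤N : length core ≤ N
      |core|≤N = ≤-trans (length-deduplicate _≟_ xs) |xs|≤N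

      N∸|core|≤|fresh| : N ∸ length core ≤ length fresh
      N∸|core|≤|fresh| = m≤n+o⇒m∸n≤o N (length core)
        (≤-trans N≤|U| (≤-trans (Unique-⊆⇒length-≤ U! U⊆core++fresh) (≤-reflexive (length-++ core))))

      |K|≡N : length K ≡ N
      |K|≡N = begin
        length K
          ≡⟨ length-++ core ⟩
        length core + length (take (N ∸ length core) fresh)
          ≡⟨ cong (length core +_) (length-take _ fresh) ⟩
        length core + ((N ∸ length core) ⊓ length fresh)
          ≡⟨ cong (length core +_) (m≤n⇒m⊓n≡m N∸|core|≤|fresh|) ⟩
        length core + (N ∸ length core)
          ≡⟨ m+[n∸m]≡n |core|≤N ⟩
        N ∎
        where open ≡-Reasoning

  length-cartesianProductWith : ∀ {A B C : Set} (f : A → B → C) xs ys →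
                                length (cartesianProductWith f xs ys) ≡ length xs * length ys
  length-cartesianProductWith f []       ys = refl
  length-cartesianProductWith f (x ∷ xs) ys =
    trans (length-++ (map (f x) ys)) (cong₂ _+_ (length-map (f x) ys) (length-cartesianProductWith f xs ys))

  module _ {A : Set} where

    vectors : ∀ n → List A → List (Vec A n)
    vectors zero    xs = [ [] ]
    vectors (suc n) xs = cartesianProductWith _∷_ xs (vectors n xs)

    length-vectors : ∀ n xs → length (vectors n xs) ≡ length xs ^ n
    length-vectors zero    xs = refl
    length-vectors (suc n) xs =
      trans (length-cartesianProductWith _∷_ xs (vectors n xs)) (cong (length xs *_) (length-vectors n xs))

    ∈-vectors : ∀ {n xs} {v : Vec A n} → VecAll.All (_∈ xs) v → v ∈ vectors n xs
    ∈-vectors VecAll.[]            = here refl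
    ∈-vectors (x∈xs VecAll.∷ v∈xs) = ∈-cartesianProductWith⁺ _∷_ x∈xs (∈-vectors v∈xs)

    vectors-Unique : ∀ n {xs} → Unique xs → Unique (vectors n xs)
    vectors-Unique zero    xs! = All.[] ∷ []
    vectors-Unique (suc n) xs! = Unique.cartesianProductWith⁺ _∷_ ∷-injective xs! (vectors-Unique n xs!)

open DuplicateFreeLists

module FieldAlgebra (𝔽 : FiniteField) where
  open FiniteField 𝔽 using (isCommutativeRing; inverse)

  commutativeRing : CommutativeRing 0ℓ 0ℓ
  commutativeRing = record { isCommutativeRing = isCommutativeRing }

  open CommutativeRing commutativeRing public
    using (Carrier; _+_; _*_; -_; _-_; 0#; 1#; +-assoc; +-comm; +-identityˡ; +-identityʳ; -‿inverseʳ;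
           *-assoc; *-comm; *-identityˡ; *-identityʳ; zeroʳ; +-commutativeSemigroup; ring)
  open import Algebra.Properties.Ring ring
    using (x∙y⁻¹≈ε⇒x≈y; x≈y⇒x∙y⁻¹≈ε; +-inverseʳ-unique; -‿+-comm; -‿distribˡ-*; x[y-z]≈xy-xz)
  open import Algebra.Properties.CommutativeSemigroup +-commutativeSemigroup using (interchange)
  open ≡-Reasoning
  open Equivalence

  x-y≡0⇔x≡y : ∀ {x y} → x - y ≡ 0# ⇔ x ≡ y
  x-y≡0⇔x≡y = mk⇔ (x∙y⁻¹≈ε⇒x≈y _ _) x≈y⇒x∙y⁻¹≈ε

  x+y≡0⇔y≡-x : ∀ {x y} → x + y ≡ 0# ⇔ y ≡ - x
  x+y≡0⇔y≡-x {x} = mk⇔ (+-inverseʳ-unique x _) λ { refl → -‿inverseʳ x }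

  x+y-y≡x : ∀ x y → (x + y) - y ≡ x
  x+y-y≡x x y = begin
    (x + y) - y   ≡⟨ +-assoc x y (- y) ⟩
    x + (y - y)   ≡⟨ cong (x +_) (-‿inverseʳ y) ⟩
    x + 0#        ≡⟨ +-identityʳ x ⟩
    x             ∎

  t*a≡b⇔t≡b*a⁻¹ : ∀ {a a⁻¹ b t} → a * a⁻¹ ≡ 1# → t * a ≡ b ⇔ t ≡ b * a⁻¹
  t*a≡b⇔t≡b*a⁻¹ {a} {a⁻¹} {b} {t} aa⁻¹≡1 = mk⇔ solve check
    where
    solve : t * a ≡ b → t ≡ b * a⁻¹
    solve refl = begin
      t               ≡⟨ *-identityʳ t ⟨
      t * 1#          ≡⟨ cong (t *_) aa⁻¹≡1 ⟨
      t * (a * a⁻¹)   ≡⟨ *-assoc t a a⁻¹ ⟨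
      t * a * a⁻¹     ∎
    check : t ≡ b * a⁻¹ → t * a ≡ b
    check refl = begin
      b * a⁻¹ * a     ≡⟨ *-assoc b a⁻¹ a ⟩
      b * (a⁻¹ * a)   ≡⟨ cong (b *_) (trans (*-comm a⁻¹ a) aa⁻¹≡1) ⟩
      b * 1#          ≡⟨ *-identityʳ b ⟩
      b               ∎

  s*x≡[s*d]*[μ*x] : ∀ {d μ} s x → d * μ ≡ 1# → s * x ≡ (s * d) * (μ * x)
  s*x≡[s*d]*[μ*x] {d} {μ} s x dμ≡1 = begin
    s * x               ≡⟨ cong (s *_) (*-identityˡ x) ⟨
    s * (1# * x)        ≡⟨ cong (λ u → s * (u * x)) dμ≡1 ⟨
    s * ((d * μ) * x)   ≡⟨ cong (s *_) (*-assoc d μ x) ⟩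
    s * (d * (μ * x))   ≡⟨ *-assoc s d (μ * x) ⟨
    (s * d) * (μ * x)   ∎

  0+s*0≡0 : ∀ s → 0# + s * 0# ≡ 0#
  0+s*0≡0 s = trans (+-identityˡ (s * 0#)) (zeroʳ s)

  module _ (f : Carrier → Carrier) where

    affine-difference : ∀ t x y → (f x + t * x) - (f y + t * y) ≡ (f x - f y) + t * (x - y)
    affine-difference t x y = begin
      (f x + t * x) - (f y + t * y)       ≡⟨ cong ((f x + t * x) +_) (-‿+-comm (f y) (t * y)) ⟨
      (f x + t * x) + (- f y + - (t * y)) ≡⟨ interchange (f x) (t * x) (- f y) (- (t * y)) ⟩
      (f x - f y) + (t * x - t * y)       ≡⟨ cong ((f x - f y) +_) (x[y-z]≈xy-xz t x y) ⟨
      (f x - f y) + t * (x - y)           ∎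

    collision⇔slope : ∀ {x y} → ¬ x ≡ y → ∃[ s ] ∀ t → (f x + t * x ≡ f y + t * y ⇔ t ≡ s)
    collision⇔slope {x} {y} x≢y with inverse (x - y) (x≢y ∘ to x-y≡0⇔x≡y)
    ... | i , [x-y]i≡1 = - (f x - f y) * i , λ t → mk⇔
      (λ collision → to (t*a≡b⇔t≡b*a⁻¹ [x-y]i≡1)
        (to x+y≡0⇔y≡-x (trans (sym (affine-difference t x y)) (from x-y≡0⇔x≡y collision))))
      (λ t≡s → to x-y≡0⇔x≡y
        (trans (affine-difference t x y) (from x+y≡0⇔y≡-x (from (t*a≡b⇔t≡b*a⁻¹ [x-y]i≡1) t≡s))))

    constant⇒linear : ∀ t c → (∀ x → f x + t * x ≡ c) → IsLinear 𝔽 f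
    constant⇒linear t c constant = - t , c , λ x → begin
      f x                     ≡⟨ x+y-y≡x (f x) (t * x) ⟨
      (f x + t * x) - t * x   ≡⟨ cong (_- t * x) (constant x) ⟩
      c - t * x               ≡⟨ cong (c +_) (-‿distribˡ-* t x) ⟩
      c + - t * x             ≡⟨ +-comm c (- t * x) ⟩
      - t * x + c             ∎

IsRank1Kakeya-mono : ∀ 𝔽 {n} {P Q : Vec (FiniteField.Carrier 𝔽) n → Set} →
                     (∀ v → P v → Q v) → IsRank1Kakeya 𝔽 n P → IsRank1Kakeya 𝔽 n Q
IsRank1Kakeya-mono 𝔽 P⊆Q kakeya d d≢0 =
  let v , line⊆P = kakeya d d≢0 in v , λ s → P⊆Q _ (line⊆P s)

module KakeyaConstruction (𝔽 : FiniteField) (f : FiniteField.Carrier 𝔽 → FiniteField.Carrier 𝔽) where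
  open FiniteField 𝔽 using (Carrier; _≟_; _+_; _*_; 0#; inverse; elements; complete)
  open FieldAlgebra 𝔽 using (+-identityˡ; s*x≡[s*d]*[μ*x]; 0+s*0≡0)

  φ : Carrier → Carrier → Carrier
  φ t x = f x + t * x

  I : Carrier → List Carrier
  I t = deduplicate _≟_ (map (φ t) elements)

  φ∈I : ∀ t x → φ t x ∈ I t
  φ∈I t x = ∈-deduplicate⁺ _≟_ (∈-map⁺ (φ t) (complete x))

  slices : ∀ n → List (Vec Carrier (suc n))
  slices n = concatMap (λ t → map (t ∷_) (vectors n (I t))) elements

  ∈-slices : ∀ {n t} (w : Vec Carrier n) → t ∷ vmap (φ t) w ∈ slices n
  ∈-slices {n} {t} w = ∈-concatMap⁺ (λ t → map (t ∷_) (vectors n (I t)))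
    (Any.map (λ { refl → ∈-map⁺ (t ∷_) (∈-vectors (VecAll.map⁺ (VecAll.universal (φ∈I t) w))) })
             (complete t))

  points : ∀ n → List (Vec Carrier n)
  points zero    = []
  points (suc n) = map (0# ∷_) (points n) ++ slices n

  length-points : ∀ n → length (points n) ≡ ∑ elements (λ t → geometric n (cardI 𝔽 f t))
  length-points zero    = sym (∑-zero elements)
  length-points (suc n) = begin
    length (map (0# ∷_) (points n) ++ slices n)
      ≡⟨ length-++ (map (0# ∷_) (points n)) ⟩
    length (map (0# ∷_) (points n)) ℕ.+ length (slices n)
      ≡⟨ cong₂ ℕ._+_ (trans (length-map (0# ∷_) (points n)) (length-points n)) length-slices ⟩
    ∑ elements (λ t → geometric n (cardI 𝔽 f t)) ℕ.+ ∑ elements (λ t → cardI 𝔽 f t ^ n)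
      ≡⟨ ∑-+ elements _ _ ⟨
    ∑ elements (λ t → geometric (suc n) (cardI 𝔽 f t)) ∎
    where
    open ≡-Reasoning
    length-slices : length (slices n) ≡ ∑ elements (λ t → cardI 𝔽 f t ^ n)
    length-slices = trans (length-concatMap _ elements)
      (∑-cong elements (λ t → trans (length-map (t ∷_) (vectors n (I t))) (length-vectors n (I t))))

  points-kakeya : ∀ n → IsRank1Kakeya 𝔽 n (_∈ points n)
  points-kakeya zero    []       d≢0 = ⊥-elim (d≢0 refl)
  points-kakeya (suc n) (d₀ ∷ d) d≢0 with d₀ ≟ 0#
  ... | yes refl =
    let v , line⊆points = points-kakeya n d (d≢0 ∘ cong (0# ∷_)) in
    0# ∷ v , λ s → subst (λ z → z ∷ zipWith _+_ v (vmap (s *_) d) ∈ points (suc n)) (sym (0+s*0≡0 s))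
                         (∈-++⁺ˡ (∈-map⁺ (0# ∷_) (line⊆points s)))
  ... | no d₀≢0 with inverse d₀ d₀≢0
  ... | μ , d₀μ≡1 =
    0# ∷ vmap f (vmap (μ *_) d) , λ s →
      subst₂ (λ z w → z ∷ w ∈ points (suc n)) (sym (+-identityˡ (s * d₀))) (sym (rescaled s d))
             (∈-++⁺ʳ (map (0# ∷_) (points n)) (∈-slices (vmap (μ *_) d)))
    where
    rescaled : ∀ {k} s (w : Vec Carrier k) →
               zipWith _+_ (vmap f (vmap (μ *_) w)) (vmap (s *_) w) ≡ vmap (φ (s * d₀)) (vmap (μ *_) w)
    rescaled s []      = refl
    rescaled s (x ∷ w) = cong₂ _∷_ (cong (f (μ * x) +_) (s*x≡[s*d]*[μ*x] s x d₀μ≡1)) (rescaled s w)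

module Counting (𝔽 : FiniteField) (f : FiniteField.Carrier 𝔽 → FiniteField.Carrier 𝔽)
                (nonlinear : NonLinear 𝔽 f) where
  open FiniteField 𝔽 using (Carrier; _≟_; 0#; 1#; 0≢1; elements; complete; unique)
  open FieldAlgebra 𝔽 using (collision⇔slope; constant⇒linear)
  open KakeyaConstruction 𝔽 f using (φ; φ∈I)
  open import Data.Nat.Base using (_+_; _*_)
  open import Data.Nat.Properties
    using (≤-trans; +-monoˡ-≤; *-identityʳ; +-identityʳ; module ≤-Reasoning)
  open Equivalence

  q : ℕ
  q = length elements

  φ-nonconstant : ∀ t c → ∃[ x ] ¬ φ t x ≡ c
  φ-nonconstant t c with any? (λ x → ¬? (φ t x ≟ c)) elements
  ... | yes somewhere = Any.satisfied somewhere
  ... | no nowhere    = ⊥-elim (nonlinear (constant⇒linear f t c constant))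
    where
    constant : ∀ x → φ t x ≡ c
    constant x = decidable-stable (φ t x ≟ c) (λ φtx≢c → nowhere (Any.map (λ { refl → φtx≢c }) (complete x)))

  2≤cardI : ∀ t → 2 ≤ cardI 𝔽 f t
  2≤cardI t with φ-nonconstant t (φ t 0#)
  ... | x , φtx≢φt0 = Unique-⊆⇒length-≤ (((φtx≢φt0 ∘ sym) All.∷ All.[]) ∷ All.[] ∷ [])
                        (λ { (here refl) → φ∈I t 0# ; (there (here refl)) → φ∈I t x })

  cardI≤q : ∀ t → cardI 𝔽 f t ≤ q
  cardI≤q t = ≤-trans (length-deduplicate _≟_ (map (φ t) elements)) (≤-reflexive (length-map (φ t) elements))

  ∑-𝟙-collision : ∀ {x y} → ¬ x ≡ y → ∑ elements (λ t → 𝟙 (φ t x ≟ φ t y)) ≡ 1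
  ∑-𝟙-collision x≢y with collision⇔slope f x≢y
  ... | s , collision⇔s = trans (∑-cong elements (λ t → 𝟙-⇔ (collision⇔s t) (φ t _ ≟ φ t _) (t ≟ s)))
                                (∑-𝟙-≡ _≟_ unique (complete s))

  extra-collision : ∃[ t ] ∃[ a ] ∃[ b ] (¬ a ≡ b × φ t a ≡ φ t b × ¬ φ t a ≡ φ t 0#)
  extra-collision with collision⇔slope f (0≢1 ∘ sym)
  ... | t₁ , collision⇔t₁ with φ-nonconstant t₁ (φ t₁ 0#)
  ... | x , φt₁x≢φt₁0 = through-1-and-x (collision⇔slope f 1≢x)
    where
    1≢x : ¬ 1# ≡ x
    1≢x 1≡x = φt₁x≢φt₁0 (subst (λ y → φ t₁ y ≡ φ t₁ 0#) 1≡x (from (collision⇔t₁ t₁) refl))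

    through-1-and-x : ∃[ t ] (∀ u → φ u 1# ≡ φ u x ⇔ u ≡ t) →
                      ∃[ t ] ∃[ a ] ∃[ b ] (¬ a ≡ b × φ t a ≡ φ t b × ¬ φ t a ≡ φ t 0#)
    through-1-and-x (t , collision⇔t) = t , 1# , x , 1≢x , φt1≡φtx , φt1≢φt0
      where
      φt1≡φtx : φ t 1# ≡ φ t x
      φt1≡φtx = from (collision⇔t t) refl
      φt1≢φt0 : ¬ φ t 1# ≡ φ t 0#
      φt1≢φt0 φt1≡φt0 = φt₁x≢φt₁0
        (subst (λ u → φ u x ≡ φ u 0#) (to (collision⇔t₁ t) φt1≡φt0) (trans (sym φt1≡φtx) φt1≡φt0))

  module Redundancy {t* a b : Carrier} (a≢b : ¬ a ≡ b) (φa≡φb : φ t* a ≡ φ t* b)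
                    (φa≢φ0 : ¬ φ t* a ≡ φ t* 0#) where

    CollidesWith0 Extra Redundant : Carrier → Carrier → Set
    CollidesWith0 t x = ¬ x ≡ 0# × φ t x ≡ φ t 0#
    Extra         t x = t ≡ t* × x ≡ b
    Redundant     t x = CollidesWith0 t x ⊎ Extra t x

    collidesWith0? : ∀ t x → Dec (CollidesWith0 t x)
    collidesWith0? t x = ¬? (x ≟ 0#) ×-dec (φ t x ≟ φ t 0#)

    extra? : ∀ t x → Dec (Extra t x)
    extra? t x = (t ≟ t*) ×-dec (x ≟ b)

    redundant? : ∀ t x → Dec (Redundant t x)
    redundant? t x = collidesWith0? t x ⊎-dec extra? t x

    #collidesWith0 #extra #redundant : Carrier → ℕ
    #collidesWith0 t = ∑ elements (λ x → 𝟙 (collidesWith0? t x))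
    #extra         t = ∑ elements (λ x → 𝟙 (extra? t x))
    #redundant     t = ∑ elements (λ x → 𝟙 (redundant? t x))

    b≢0 : ¬ b ≡ 0#
    b≢0 b≡0 = φa≢φ0 (trans φa≡φb (cong (φ t*) b≡0))

    disjoint : ∀ t x → ¬ (CollidesWith0 t x × Extra t x)
    disjoint t x ((_ , φx≡φ0) , refl , refl) = φa≢φ0 (trans φa≡φb φx≡φ0)

    representative : ∀ t x → ∃[ y ] ¬ Redundant t y × φ t y ≡ φ t x
    representative t x with φ t x ≟ φ t 0# | extra? t x
    ... | yes φx≡φ0 | _ =
      0# , (λ { (inj₁ (0≢0 , _)) → 0≢0 refl ; (inj₂ (_ , 0≡b)) → b≢0 (sym 0≡b) }) , sym φx≡φ0
    ... | no φx≢φ0 | yes (refl , refl) =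
      a , (λ { (inj₁ (_ , φa≡φ0)) → φa≢φ0 φa≡φ0 ; (inj₂ (_ , a≡b)) → a≢b a≡b }) , φa≡φb
    ... | no φx≢φ0 | no ¬extra =
      x , (λ { (inj₁ (_ , φx≡φ0)) → φx≢φ0 φx≡φ0 ; (inj₂ extra) → ¬extra extra }) , refl

    cardI+#redundant≤q : ∀ t → cardI 𝔽 f t + #redundant t ≤ q
    cardI+#redundant≤q t = begin
      cardI 𝔽 f t + #redundant t                    ≤⟨ +-monoˡ-≤ (#redundant t) cardI≤#kept ⟩
      length (filter kept? elements) + #redundant t ≡⟨ cong (_+ #redundant t) (length-filter≡∑𝟙 kept? elements) ⟩
      ∑ elements (λ x → 𝟙 (kept? x)) + #redundant t ≡⟨ ∑-𝟙-complement (redundant? t) elements ⟩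
      q                                             ∎
      where
      open ≤-Reasoning
      kept? = λ x → ¬? (redundant? t x)
      cardI≤#kept : cardI 𝔽 f t ≤ length (filter kept? elements)
      cardI≤#kept = length-deduplicate-map-≤ _≟_ (φ t) {xs = elements} λ {x} _ →
        let y , ¬redundant , φy≡φx = representative t x in y , ∈-filter⁺ kept? (complete y) ¬redundant , φy≡φx

    ∑#collidesWith0+1≡q : ∑ elements #collidesWith0 + 1 ≡ q
    ∑#collidesWith0+1≡q = begin
      ∑ elements #collidesWith0 + 1
        ≡⟨ cong (_+ 1) (∑-comm elements elements _) ⟩
      ∑ elements (λ x → ∑ elements (λ t → 𝟙 (collidesWith0? t x))) + 1
        ≡⟨ cong₂ _+_ (∑-cong elements slopes-through-0) (sym (∑-𝟙-≡ _≟_ unique (complete 0#))) ⟩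
      ∑ elements (λ x → 𝟙 (¬? (x ≟ 0#))) + ∑ elements (λ x → 𝟙 (x ≟ 0#))
        ≡⟨ ∑-𝟙-complement (_≟ 0#) elements ⟩
      q ∎
      where
      open ≡-Reasoning
      weight : ∀ {x} (x≟0 : Dec (x ≡ 0#)) →
               𝟙 (¬? x≟0) * ∑ elements (λ t → 𝟙 (φ t x ≟ φ t 0#)) ≡ 𝟙 (¬? x≟0)
      weight (yes _)  = refl
      weight (no x≢0) = trans (+-identityʳ _) (∑-𝟙-collision x≢0)

      slopes-through-0 : ∀ x → ∑ elements (λ t → 𝟙 (collidesWith0? t x)) ≡ 𝟙 (¬? (x ≟ 0#))
      slopes-through-0 x = begin
        ∑ elements (λ t → 𝟙 (collidesWith0? t x))
          ≡⟨ ∑-cong elements (λ t → 𝟙-× (¬? (x ≟ 0#)) (φ t x ≟ φ t 0#)) ⟩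
        ∑ elements (λ t → 𝟙 (¬? (x ≟ 0#)) * 𝟙 (φ t x ≟ φ t 0#))
          ≡⟨ ∑-*ˡ elements (𝟙 (¬? (x ≟ 0#))) _ ⟩
        𝟙 (¬? (x ≟ 0#)) * ∑ elements (λ t → 𝟙 (φ t x ≟ φ t 0#))
          ≡⟨ weight (x ≟ 0#) ⟩
        𝟙 (¬? (x ≟ 0#)) ∎

    ∑#extra≡1 : ∑ elements #extra ≡ 1
    ∑#extra≡1 = begin
      ∑ elements #extra
        ≡⟨ ∑-cong elements (λ t → trans (∑-cong elements (λ x → 𝟙-× (t ≟ t*) (x ≟ b)))
                                          (∑-*ˡ elements (𝟙 (t ≟ t*)) _)) ⟩
      ∑ elements (λ t → 𝟙 (t ≟ t*) * ∑ elements (λ x → 𝟙 (x ≟ b)))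
        ≡⟨ ∑-cong elements (λ t → cong (𝟙 (t ≟ t*) *_) (∑-𝟙-≡ _≟_ unique (complete b))) ⟩
      ∑ elements (λ t → 𝟙 (t ≟ t*) * 1)
        ≡⟨ ∑-cong elements (λ t → *-identityʳ _) ⟩
      ∑ elements (λ t → 𝟙 (t ≟ t*))
        ≡⟨ ∑-𝟙-≡ _≟_ unique (complete t*) ⟩
      1 ∎
      where open ≡-Reasoning

    ∑#redundant≡q : ∑ elements #redundant ≡ q
    ∑#redundant≡q = begin
      ∑ elements #redundant
        ≡⟨ ∑-cong elements #redundant≡ ⟩
      ∑ elements (λ t → #collidesWith0 t + #extra t)
        ≡⟨ ∑-+ elements _ _ ⟩
      ∑ elements #collidesWith0 + ∑ elements #extra
        ≡⟨ cong (∑ elements #collidesWith0 +_) ∑#extra≡1 ⟩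
      ∑ elements #collidesWith0 + 1
        ≡⟨ ∑#collidesWith0+1≡q ⟩
      q ∎
      where
      open ≡-Reasoning
      #redundant≡ : ∀ t → #redundant t ≡ #collidesWith0 t + #extra t
      #redundant≡ t = trans (∑-cong elements (λ x → 𝟙-⊎ (disjoint t x) (collidesWith0? t x) (extra? t x)))
                            (∑-+ elements _ _)

    ∑cardI+q≤q² : ∑ elements (cardI 𝔽 f) + q ≤ q * q
    ∑cardI+q≤q² = begin
      ∑ elements (cardI 𝔽 f) + q                     ≡⟨ cong (_ +_) ∑#redundant≡q ⟨
      ∑ elements (cardI 𝔽 f) + ∑ elements #redundant ≡⟨ ∑-+ elements _ _ ⟨
      ∑ elements (λ t → cardI 𝔽 f t + #redundant t)  ≤⟨ ∑-mono-≤ elements cardI+#redundant≤q ⟩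
      ∑ elements (λ _ → q)                           ≡⟨ ∑-const elements q ⟩
      q * q                                          ∎
      where open ≤-Reasoning

  ∑cardI+q≤q² : ∑ elements (cardI 𝔽 f) + q ≤ q * q
  ∑cardI+q≤q² = let _ , _ , _ , a≢b , φa≡φb , φa≢φ0 = extra-collision in
                Redundancy.∑cardI+q≤q² a≢b φa≡φb φa≢φ0

lemma7 : (n : ℕ) → n ≥ 1 → (𝔽 : FiniteField) → (f : FiniteField.Carrier 𝔽 → FiniteField.Carrier 𝔽) →
  NonLinear 𝔽 f →
  ∃[ K ] (Unique {A = Vec (FiniteField.Carrier 𝔽) n} K × IsRank1Kakeya 𝔽 n (λ x → x ∈ K)
    × length K ≡ sum (map (λ t → quot (cardI 𝔽 f t ^ n ∸ 1) (cardI 𝔽 f t ∸ 1)) (FiniteField.elements 𝔽)))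
lemma7 n _ 𝔽 f nonlinear =
  let K , K! , points⊆K , |K|≡N =
        Unique-⊇-ofLength (≡-dec _≟_) (vectors-Unique n unique) N≤|𝔽ⁿ|
                          (points n) (≤-reflexive (length-points n))
  in K , K! , IsRank1Kakeya-mono 𝔽 (λ v → points⊆K {v}) (points-kakeya n)
       , trans |K|≡N (∑-cong elements (λ t → sym (quot≡geometric n (2≤cardI t))))
  where
  open FiniteField 𝔽 using (_≟_; elements; unique)
  open KakeyaConstruction 𝔽 f using (points; length-points; points-kakeya)
  open Counting 𝔽 f nonlinear using (2≤cardI; cardI≤q; ∑cardI+q≤q²)

  N : ℕ
  N = ∑ elements (λ t → geometric n (cardI 𝔽 f t))

  N≤|𝔽ⁿ| : N ≤ length (vectors n elements)
  N≤|𝔽ⁿ| = subst (N ≤_) (sym (length-vectors n elements))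
                  (∑-geometric-≤ elements (cardI 𝔽 f) refl cardI≤q ∑cardI+q≤q² n)
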